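{- Let $n=p_1^{\alpha_1}\cdots p_k^{\alpha_k}$ and $m=q_1^{\beta_1}\cdots q_l^{\beta_l}$ be prime power factorizations (distinct primes $p_i$, distinct primes $q_j$) with $k\ge2$, $l\ge2$, $\alpha_1\ge\cdots\ge\alpha_k\ge1$ and $\beta_1\ge\cdots\ge\beta_l\ge1$. If $\Upsilon_n\cong\Upsilon_m$, then $n$ and $m$ are similar, i.e. $k=l$ and $\alpha_i=\beta_i$ for all $i\in\{1,\dots,k\}$.
   Context: For an integer $n>1$, a proper divisor of $n$ is an integer $d$ with $1<d<n$ and $d\mid n$. The proper divisor graph $\Upsilon_n$ is the simple graph whose vertices are the proper divisors of $n$, two distinct vertices $u,v$ being adjacent iff $n\mid uv$. -}

module Defs where

open import Data.Nat using (ℕ; _<_; _≤_; _*_; _^_)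
open import Data.Nat.Divisibility using (_∣_)
open import Data.Nat.Primality using (Prime)
open import Data.Fin using (Fin; toℕ)
open import Data.List using (tabulate)
open import Data.Nat.ListAction using (product)
open import Data.Product using (_×_)
open import Function.Bundles using (_⤖_; Bijection; _⇔_)
open import Function.Definitions using (Injective)
open import Relation.Binary.PropositionalEquality using (_≡_; _≢_)

-- Vertices of Υ_n: proper divisors d of n, 1 < d < n, d ∣ n.
record ProperDivisor (n : ℕ) : Set where
  constructor pd
  field
    val   : ℕ
    1<val : 1 < val
    val<n : val < n
    val∣n : val ∣ n
open ProperDivisor public

Adj : (n : ℕ) → ProperDivisor n → ProperDivisor n → Set
Adj n u v = (val u ≢ val v) × (n ∣ val u * val v)

record ΥIso (n m : ℕ) : Set where
  field
    bij      : ProperDivisor n ⤖ ProperDivisor m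
    adj-iff  : ∀ u v → Adj n u v ⇔ Adj m (Bijection.to bij u) (Bijection.to bij v)

record OrderedFactorization (n k : ℕ) (p α : Fin k → ℕ) : Set where
  field
    prime    : ∀ i → Prime (p i)
    distinct : Injective _≡_ _≡_ p
    pos      : ∀ i → 1 ≤ α i
    nonincr  : ∀ i j → toℕ i ≤ toℕ j → α j ≤ α i
    eq       : n ≡ product (tabulate (λ i → p i ^ α i))

-- Since n is not a prime power, the vertices of Υ_n of degree one are exactly the primes pᵢ,
-- each adjacent only to n/pᵢ; so an isomorphism Υ_n ≅ Υ_m matches the primes of n with those of m.
-- The vertices adjacent to n/pᵢ but to no other n/pⱼ are the powers pᵢ, …, pᵢ^αᵢ, together with
-- n/pⱼ when k = 2 and αⱼ ≥ 2; the isomorphism preserves their number. These counts, listed in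
-- the order of the exponents, are nonincreasing, hence agree for n and m term by term, and they
-- determine the exponents: for k ≥ 3 they are the αᵢ themselves, and for k = 2 the possible extra
-- vertex is pinned down by the ordering.

module Submission where

open import Data.Nat
  using (ℕ; zero; suc; _+_; _*_; _^_; _∸_; _≤_; _<_; z≤n; s≤s; s≤s⁻¹; z<s; _≟_; _≤?_; NonZero; >-nonZero; nonTrivial⇒n>1)
open import Data.Nat.Properties
open import Data.Nat.Divisibility
open import Data.Nat.Primality
open import Data.Nat.Primality.Factorisation using (factorise; PrimeFactorisation)
open import Data.Nat.ListAction using (product)
open import Data.Nat.ListAction.Properties using (∈⇒∣product; product≢0)
open import Data.List using ([]; _∷_; length; tabulate)
open import Data.List.Relation.Unary.All using (All; []; _∷_; lookup) renaming (tabulate to All-tabulate)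
import Data.List.Relation.Unary.All.Properties as All
open import Data.List.Relation.Unary.Any using (Any; here; there)
import Data.List.Relation.Unary.Any.Properties as Any
open import Data.List.Membership.Propositional.Properties using (∈-tabulate⁺)
open import Data.Fin using (Fin; toℕ; fromℕ<) renaming (zero to fz; suc to fs)
import Data.Fin.Properties
open import Data.Fin.Properties using (any?; all?; toℕ<n; toℕ-fromℕ<; toℕ-injective) renaming (_≟_ to _≟ᶠ_)
import Data.Product
open import Data.Product using (Σ; _×_; _,_; proj₁; proj₂; ∃-syntax)
open import Data.Sum using (_⊎_; inj₁; inj₂; swap; [_,_]′)
open import Data.Empty using (⊥; ⊥-elim)
open import Relation.Nullary using (¬_; Dec; yes; no)
open import Relation.Nullary.Decidable using (¬?; _×-dec_; _⊎-dec_)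
open import Relation.Binary.PropositionalEquality
  using (_≡_; _≢_; ≢-sym; refl; sym; trans; cong; subst; subst₂; module ≡-Reasoning)
open import Function using (_∘_; id; case_of_)
open import Function.Definitions using (Injective)
open import Function.Bundles using (Equivalence; _⇔_; mk⇔; Inverse; _↔_)
open import Function.Properties.Equivalence using () renaming (sym to ⇔-sym; trans to ⇔-trans)
open import Function.Properties.Inverse using (↔-sym)
open import Function.Properties.Bijection using (⤖⇒↔)
open import Defs

prime⇒2≤ : ∀ {p} → Prime p → 2 ≤ p
prime⇒2≤ {p} pr = nonTrivial⇒n>1 p {{prime⇒nonTrivial pr}}

prime∤1 : ∀ {p} → Prime p → ¬ p ∣ 1
prime∤1 pr p∣1 = ¬prime[1] (subst Prime (∣1⇒≡1 p∣1) pr)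

prime∣prime⇒≡ : ∀ {r q} → Prime r → Prime q → r ∣ q → r ≡ q
prime∣prime⇒≡ pr pq r∣q with prime⇒irreducible pq r∣q
... | inj₁ refl = ⊥-elim (¬prime[1] pr)
... | inj₂ r≡q  = r≡q

prime∣^⇒≡ : ∀ {r q} t → Prime r → Prime q → r ∣ q ^ t → r ≡ q
prime∣^⇒≡ zero    pr pq r∣1 = ⊥-elim (prime∤1 pr r∣1)
prime∣^⇒≡ {q = q} (suc t) pr pq r∣q^t+1 with euclidsLemma q (q ^ t) pr r∣q^t+1
... | inj₁ r∣q   = prime∣prime⇒≡ pr pq r∣q
... | inj₂ r∣q^t = prime∣^⇒≡ t pr pq r∣q^t

prime∣product : ∀ {r} xs → Prime r → r ∣ product xs → Any (r ∣_) xs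
prime∣product []       pr r∣1 = ⊥-elim (prime∤1 pr r∣1)
prime∣product (x ∷ xs) pr r∣x*Πxs with euclidsLemma x (product xs) pr r∣x*Πxs
... | inj₁ r∣x   = here r∣x
... | inj₂ r∣Πxs = there (prime∣product xs pr r∣Πxs)

^-monoʳ-∣ : ∀ P {a b} → a ≤ b → P ^ a ∣ P ^ b
^-monoʳ-∣ P {a} {b} a≤b = divides (P ^ (b ∸ a)) (begin
  P ^ b               ≡⟨ cong (P ^_) (sym (m+[n∸m]≡n a≤b)) ⟩
  P ^ (a + (b ∸ a))   ≡⟨ ^-distribˡ-+-* P a (b ∸ a) ⟩
  P ^ a * P ^ (b ∸ a) ≡⟨ *-comm (P ^ a) _ ⟩
  P ^ (b ∸ a) * P ^ a ∎)
  where open ≡-Reasoning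

product-constant : ∀ {P} xs → All (_≡ P) xs → product xs ≡ P ^ length xs
product-constant []       []           = refl
product-constant (x ∷ xs) (refl ∷ xs≡) = cong (x *_) (product-constant xs xs≡)

onlyPrimeFactor⇒power : ∀ {P x} .{{_ : NonZero x}} → (∀ r → Prime r → r ∣ x → r ≡ P) → ∃[ t ] x ≡ P ^ t
onlyPrimeFactor⇒power {P} {x} onlyP = length factors , trans isFactorisation (product-constant factors factors≡P)
  where
  open PrimeFactorisation (factorise x)
  factors≡P : All (_≡ P) factors
  factors≡P = All-tabulate λ r∈ →
    onlyP _ (lookup factorsPrime r∈) (subst (_ ∣_) (sym isFactorisation) (∈⇒∣product r∈))

^∣^*⇒≤ : ∀ {P Q} t a → Prime P → ¬ P ∣ Q → P ^ t ∣ P ^ a * Q → t ≤ a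
^∣^*⇒≤         zero    a       pP P∤Q _ = z≤n
^∣^*⇒≤ {P} {Q} (suc t) zero    pP P∤Q P^t+1∣Q =
  ⊥-elim (P∤Q (∣-trans (m∣m*n (P ^ t)) (subst (P ^ suc t ∣_) (+-identityʳ Q) P^t+1∣Q)))
^∣^*⇒≤ {P} {Q} (suc t) (suc a) pP P∤Q P^t+1∣P^a+1*Q = s≤s (^∣^*⇒≤ t a pP P∤Q
  (*-cancelˡ-∣ P {{prime⇒nonZero pP}} (subst (P * P ^ t ∣_) (*-assoc P (P ^ a) Q) P^t+1∣P^a+1*Q)))

^∣*⇒^∣ : ∀ {P Q N} t → Prime P → ¬ P ∣ Q → P ^ t ∣ Q * N → P ^ t ∣ N
^∣*⇒^∣         zero    pP P∤Q _ = 1∣ _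
^∣*⇒^∣ {P} {Q} (suc t) pP P∤Q P^t+1∣Q*N with euclidsLemma Q _ pP (∣-trans (m∣m*n (P ^ t)) P^t+1∣Q*N)
... | inj₁ P∣Q = ⊥-elim (P∤Q P∣Q)
... | inj₂ (divides N′ refl) = subst (_∣ N′ * P) (*-comm (P ^ t) P) (*-monoˡ-∣ P P^t∣N′)
  where
  P^t∣N′ : P ^ t ∣ N′
  P^t∣N′ = ^∣*⇒^∣ t pP P∤Q (*-cancelˡ-∣ P {{prime⇒nonZero pP}}
    (subst (P * P ^ t ∣_) (trans (sym (*-assoc Q N′ P)) (*-comm (Q * N′) P)) P^t+1∣Q*N))

^-injectiveʳ : ∀ {P a b} → Prime P → P ^ a ≡ P ^ b → a ≡ b
^-injectiveʳ {P} pP P^a≡P^b = ≤-antisym (≤ʳ P^a≡P^b) (≤ʳ (sym P^a≡P^b))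
  where
  ≤ʳ : ∀ {x y} → P ^ x ≡ P ^ y → x ≤ y
  ≤ʳ {x} {y} eq = ^∣^*⇒≤ x y pP (prime∤1 pP) (subst (P ^ x ∣_) (sym (*-identityʳ (P ^ y))) (∣-reflexive eq))

∣-irrelevant : ∀ {d m} → 0 < d → (x y : d ∣ m) → x ≡ y
∣-irrelevant 0<d (divides q₁ eq₁) (divides q₂ eq₂) with *-cancelʳ-≡ q₁ q₂ _ {{>-nonZero 0<d}} (trans (sym eq₁) eq₂)
... | refl = cong (divides q₁) (≡-irrelevant eq₁ eq₂)

two-of-three-equal : ∀ {s t u v w : ℕ} → u ≡ s ⊎ u ≡ t → v ≡ s ⊎ v ≡ t → w ≡ s ⊎ w ≡ t →
  u ≡ v ⊎ u ≡ w ⊎ v ≡ w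
two-of-three-equal (inj₁ refl) (inj₁ refl) _           = inj₁ refl
two-of-three-equal (inj₂ refl) (inj₂ refl) _           = inj₁ refl
two-of-three-equal (inj₁ refl) (inj₂ refl) (inj₁ refl) = inj₂ (inj₁ refl)
two-of-three-equal (inj₁ refl) (inj₂ refl) (inj₂ refl) = inj₂ (inj₂ refl)
two-of-three-equal (inj₂ refl) (inj₁ refl) (inj₁ refl) = inj₂ (inj₂ refl)
two-of-three-equal (inj₂ refl) (inj₁ refl) (inj₂ refl) = inj₂ (inj₁ refl)

distinct⇒one≡first : ∀ {s t u v : ℕ} → u ≢ v → u ≡ s ⊎ u ≡ t → v ≡ s ⊎ v ≡ t → u ≡ s ⊎ v ≡ s
distinct⇒one≡first u≢v (inj₁ u≡s) _           = inj₁ u≡s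
distinct⇒one≡first u≢v (inj₂ _)   (inj₁ v≡s)  = inj₂ v≡s
distinct⇒one≡first u≢v (inj₂ refl) (inj₂ refl) = ⊥-elim (u≢v refl)

≢0∧≢1⇒2≤ : ∀ {m} → m ≢ 0 → m ≢ 1 → 2 ≤ m
≢0∧≢1⇒2≤ {0}           m≢0 _   = ⊥-elim (m≢0 refl)
≢0∧≢1⇒2≤ {1}           _   m≢1 = ⊥-elim (m≢1 refl)
≢0∧≢1⇒2≤ {suc (suc _)} _   _   = s≤s (s≤s z≤n)

m*[m*m]≡m^3 : ∀ m → m * (m * m) ≡ m ^ 3
m*[m*m]≡m^3 m = cong (λ z → m * (m * z)) (sym (*-identityʳ m))

[m*m]*[m*m]≡m^4 : ∀ m → (m * m) * (m * m) ≡ m ^ 4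
[m*m]*[m*m]≡m^4 m = trans (*-assoc m m (m * m)) (cong (m *_) (m*[m*m]≡m^3 m))

prime-factor : ∀ x → 2 ≤ x → ∃[ r ] ∃[ y ] Prime r × x ≡ y * r
prime-factor x@(suc _) 2≤x with factorise x
... | record { factors = [] ; isFactorisation = x≡1 } = ⊥-elim (<-irrefl (sym x≡1) 2≤x)
... | record { factors = r ∷ rs ; isFactorisation = x≡r*Πrs ; factorsPrime = pr ∷ _ } =
  r , product rs , pr , trans x≡r*Πrs (*-comm r (product rs))

primePowerProduct : ∀ {k} → (p α : Fin k → ℕ) → ℕ
primePowerProduct p α = product (tabulate (λ i → p i ^ α i))

module _ {k} (p α : Fin k → ℕ) (isPrime : ∀ i → Prime (p i)) where

  ^∣primePowerProduct : ∀ i → p i ^ α i ∣ primePowerProduct p α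
  ^∣primePowerProduct i = ∈⇒∣product (∈-tabulate⁺ i)

  primePowerProduct≢0 : NonZero (primePowerProduct p α)
  primePowerProduct≢0 = product≢0 (All.tabulate⁺ λ i → m^n≢0 (p i) (α i) {{prime⇒nonZero (isPrime i)}})

  prime∣primePowerProduct : ∀ {r} → Prime r → r ∣ primePowerProduct p α → ∃[ i ] r ≡ p i
  prime∣primePowerProduct pr r∣Π with Any.tabulate⁻ (prime∣product _ pr r∣Π)
  ... | i , r∣p^α = i , prime∣^⇒≡ (α i) pr (isPrime i) r∣p^α

^∣primePowerProduct⇒≤ : ∀ {k} (p α : Fin k → ℕ) → (∀ i → Prime (p i)) → Injective _≡_ _≡_ p →
  ∀ i t → p i ^ t ∣ primePowerProduct p α → t ≤ α i
^∣primePowerProduct⇒≤ p α isPrime inj fz t p^t∣Π = ^∣^*⇒≤ t (α fz) (isPrime fz) p₀∤rest p^t∣Π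
  where
  p₀∤rest : ¬ p fz ∣ primePowerProduct (p ∘ fs) (α ∘ fs)
  p₀∤rest p₀∣rest with prime∣primePowerProduct (p ∘ fs) (α ∘ fs) (isPrime ∘ fs) (isPrime fz) p₀∣rest
  ... | j , p₀≡pⱼ with inj p₀≡pⱼ
  ... | ()
^∣primePowerProduct⇒≤ p α isPrime inj (fs i) t p^t∣Π =
  ^∣primePowerProduct⇒≤ (p ∘ fs) (α ∘ fs) (isPrime ∘ fs) (Data.Fin.Properties.suc-injective ∘ inj) i t
    (^∣*⇒^∣ t (isPrime (fs i)) pᵢ∤p₀^α₀ p^t∣Π)
  where
  pᵢ∤p₀^α₀ : ¬ p (fs i) ∣ p fz ^ α fz
  pᵢ∤p₀^α₀ pᵢ∣p₀^α₀ with inj (prime∣^⇒≡ (α fz) (isPrime (fs i)) (isPrime fz) pᵢ∣p₀^α₀)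
  ... | ()

module _ {V : Set} (E : V → V → Set) where

  Pendant : V → V → Set
  Pendant a c = E a c × (∀ w → E a w → w ≡ c)

  Private : V → V → Set
  Private a v = (∀ c → Pendant a c → E v c) × (∀ a′ c′ → Pendant a′ c′ → a′ ≢ a → ¬ E v c′)

record Enumeration {A : Set} (S : A → Set) (c : ℕ) : Set where
  field
    elem            : Fin c → A
    elem∈           : ∀ x → S (elem x)
    elem-injective  : Injective _≡_ _≡_ elem
    elem-surjective : ∀ v → S v → ∃[ x ] elem x ≡ v

Enumeration-≤ : ∀ {A B : Set} {S : A → Set} {T : B → Set} {c d} (f : A → B) →
  Injective _≡_ _≡_ f → (∀ v → S v → T (f v)) → Enumeration S c → Enumeration T d → c ≤ d
Enumeration-≤ f f-inj f[S]⊆T enumS enumT = Data.Fin.Properties.injective⇒≤ g-injective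
  where
  open Enumeration
  g : Fin _ → Fin _
  g x = proj₁ (elem-surjective enumT (f (elem enumS x)) (f[S]⊆T _ (elem∈ enumS x)))
  elem-g : ∀ x → elem enumT (g x) ≡ f (elem enumS x)
  elem-g x = proj₂ (elem-surjective enumT (f (elem enumS x)) (f[S]⊆T _ (elem∈ enumS x)))
  g-injective : Injective _≡_ _≡_ g
  g-injective {x} {y} gx≡gy = elem-injective enumS (f-inj (begin
    f (elem enumS x)  ≡⟨ sym (elem-g x) ⟩
    elem enumT (g x)  ≡⟨ cong (elem enumT) gx≡gy ⟩
    elem enumT (g y)  ≡⟨ elem-g y ⟩
    f (elem enumS y)  ∎))
    where open ≡-Reasoning

Enumeration-cong : ∀ {A : Set} {S T : A → Set} {c} → (∀ v → S v ⇔ T v) → Enumeration S c → Enumeration T c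
Enumeration-cong S⇔T enumS = record
  { elem            = elem
  ; elem∈           = λ x → Equivalence.to (S⇔T _) (elem∈ x)
  ; elem-injective  = elem-injective
  ; elem-surjective = λ v Tv → elem-surjective v (Equivalence.from (S⇔T v) Tv)
  }
  where open Enumeration enumS

Enumeration-suc : ∀ {A : Set} {S T : A → Set} {c} (a : A) → ¬ S a → (∀ v → T v ⇔ (S v ⊎ v ≡ a)) →
  Enumeration S c → Enumeration T (suc c)
Enumeration-suc {S = S} {T} a a∉S T⇔S∪a enumS = record
  { elem            = elem′
  ; elem∈           = elem′∈
  ; elem-injective  = elem′-injective
  ; elem-surjective = elem′-surjective
  }
  where
  open Enumeration enumS
  elem′ : Fin (suc _) → _
  elem′ fz     = a
  elem′ (fs x) = elem x
  elem′∈ : ∀ x → T (elem′ x)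
  elem′∈ fz     = Equivalence.from (T⇔S∪a a) (inj₂ refl)
  elem′∈ (fs x) = Equivalence.from (T⇔S∪a _) (inj₁ (elem∈ x))
  elem′-injective : Injective _≡_ _≡_ elem′
  elem′-injective {fz}   {fz}   _  = refl
  elem′-injective {fz}   {fs y} eq = ⊥-elim (a∉S (subst S (sym eq) (elem∈ y)))
  elem′-injective {fs x} {fz}   eq = ⊥-elim (a∉S (subst S eq (elem∈ x)))
  elem′-injective {fs x} {fs y} eq = cong fs (elem-injective eq)
  elem′-surjective : ∀ v → T v → ∃[ x ] elem′ x ≡ v
  elem′-surjective v Tv with Equivalence.to (T⇔S∪a v) Tv
  ... | inj₁ Sv   = let x , eq = elem-surjective v Sv in fs x , eq
  ... | inj₂ refl = fz , refl

record GraphIso {V W : Set} (E : V → V → Set) (F : W → W → Set) : Set where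
  field
    vertices : V ↔ W
    adjacent : ∀ u v → E u v ⇔ F (Inverse.to vertices u) (Inverse.to vertices v)

GraphIso-sym : ∀ {V W : Set} {E : V → V → Set} {F : W → W → Set} → GraphIso E F → GraphIso F E
GraphIso-sym {E = E} {F} G = record
  { vertices = ↔-sym vertices
  ; adjacent = λ u v → subst₂ (λ u′ v′ → F u′ v′ ⇔ E (from u) (from v))
      (strictlyInverseˡ u) (strictlyInverseˡ v) (⇔-sym (adjacent (from u) (from v)))
  }
  where
  open GraphIso G
  open Inverse vertices

module _ {V W : Set} {E : V → V → Set} {F : W → W → Set} (G : GraphIso E F) where
  open GraphIso G
  open Inverse vertices

  to-injective : Injective _≡_ _≡_ to
  to-injective {x} {y} tx≡ty = trans (sym (strictlyInverseʳ x)) (trans (cong from tx≡ty) (strictlyInverseʳ y))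

  private
    adj→ : ∀ {u v} → E u v → F (to u) (to v)
    adj→ = Equivalence.to (adjacent _ _)

    adj← : ∀ {u v} → F (to u) (to v) → E u v
    adj← = Equivalence.from (adjacent _ _)

    adj←ʳ : ∀ {u w} → F (to u) w → E u (from w)
    adj←ʳ {u} {w} Fuw = adj← (subst (F (to u)) (sym (strictlyInverseˡ w)) Fuw)

  Pendant-preimage : ∀ {a c} → Pendant F (to a) (to c) → Pendant E a c
  Pendant-preimage (Fac , unique) = adj← Fac , λ w Eaw → to-injective (unique (to w) (adj→ Eaw))

  Pendant-image : ∀ {a c} → Pendant E a c → Pendant F (to a) (to c)
  Pendant-image (Eac , unique) = adj→ Eac , λ w Faw →
    trans (sym (strictlyInverseˡ w)) (cong to (unique (from w) (adj←ʳ Faw)))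

  Private-image : ∀ {a v} → Private E a v → Private F (to a) (to v)
  Private-image {a} {v} (adjacentToAnchor , avoidsOthers) = adjacentToAnchor′ , avoidsOthers′
    where
    preimage-pendant : ∀ {a′ c′} → Pendant F a′ c′ → Pendant E (from a′) (from c′)
    preimage-pendant {a′} {c′} =
      Pendant-preimage ∘ subst₂ (Pendant F) (sym (strictlyInverseˡ a′)) (sym (strictlyInverseˡ c′))
    adjacentToAnchor′ : ∀ c → Pendant F (to a) c → F (to v) c
    adjacentToAnchor′ c pend = subst (F (to v)) (strictlyInverseˡ c)
      (adj→ (adjacentToAnchor (from c)
        (subst (λ x → Pendant E x (from c)) (strictlyInverseʳ a) (preimage-pendant pend))))
    avoidsOthers′ : ∀ a′ c′ → Pendant F a′ c′ → a′ ≢ to a → ¬ F (to v) c′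
    avoidsOthers′ a′ c′ pend a′≢ Fvc′ = avoidsOthers (from a′) (from c′) (preimage-pendant pend)
      (λ eq → a′≢ (trans (sym (strictlyInverseˡ a′)) (cong to eq))) (adj←ʳ Fvc′)

  Private-size-≤ : ∀ {a c d} → Enumeration (Private E a) c → Enumeration (Private F (to a)) d → c ≤ d
  Private-size-≤ = Enumeration-≤ to to-injective (λ _ → Private-image)

Nonincreasing : ∀ {K} → (Fin K → ℕ) → Set
Nonincreasing a = ∀ i j → toℕ i ≤ toℕ j → a j ≤ a i

-- If b = a ∘ τ with τ injective and b i > a i, then τ maps the i + 1 indices ≤ i into the i indices < i.
reindex-≤ : ∀ {K} {a b : Fin K → ℕ} (τ : Fin K → Fin K) → Injective _≡_ _≡_ τ →
  Nonincreasing a → Nonincreasing b → (∀ j → b j ≡ a (τ j)) → ∀ i → b i ≤ a i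
reindex-≤ {a = a} {b} τ τ-injective a↓ b↓ b≡a∘τ i with b i ≤? a i
... | yes bi≤ai = bi≤ai
... | no bi≰ai = ⊥-elim (<-irrefl refl (Data.Fin.Properties.injective⇒≤ g-injective))
  where
  prefix : Fin (suc (toℕ i)) → Fin _
  prefix x = fromℕ< (≤-<-trans (s≤s⁻¹ (toℕ<n x)) (toℕ<n i))
  toℕ-prefix : ∀ x → toℕ (prefix x) ≡ toℕ x
  toℕ-prefix x = toℕ-fromℕ< _
  τ-prefix<i : ∀ x → toℕ (τ (prefix x)) < toℕ i
  τ-prefix<i x with toℕ i ≤? toℕ (τ (prefix x))
  ... | no i≰ = ≰⇒> i≰
  ... | yes i≤ = ⊥-elim (bi≰ai (begin
    b i             ≤⟨ b↓ (prefix x) i (subst (_≤ toℕ i) (sym (toℕ-prefix x)) (s≤s⁻¹ (toℕ<n x))) ⟩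
    b (prefix x)     ≡⟨ b≡a∘τ (prefix x) ⟩
    a (τ (prefix x)) ≤⟨ a↓ i _ i≤ ⟩
    a i             ∎))
    where open ≤-Reasoning
  g : Fin (suc (toℕ i)) → Fin (toℕ i)
  g x = fromℕ< (τ-prefix<i x)
  g-injective : Injective _≡_ _≡_ g
  g-injective {x} {y} gx≡gy = toℕ-injective (begin
    toℕ x             ≡⟨ sym (toℕ-prefix x) ⟩
    toℕ (prefix x)     ≡⟨ cong toℕ (τ-injective (toℕ-injective (begin
      toℕ (τ (prefix x)) ≡⟨ sym (toℕ-fromℕ< _) ⟩
      toℕ (g x)         ≡⟨ cong toℕ gx≡gy ⟩
      toℕ (g y)         ≡⟨ toℕ-fromℕ< _ ⟩
      toℕ (τ (prefix y)) ∎))) ⟩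
    toℕ (prefix y)     ≡⟨ toℕ-prefix y ⟩
    toℕ y             ∎)
    where open ≡-Reasoning

record Embeds {K L} (a : Fin K → ℕ) (b : Fin L → ℕ) : Set where
  field
    index           : Fin K → Fin L
    index-injective : Injective _≡_ _≡_ index
    reindexes       : ∀ i → a i ≡ b (index i)

Embeds⇒≤ : ∀ {K L} {a : Fin K → ℕ} {b : Fin L → ℕ} → Embeds a b → K ≤ L
Embeds⇒≤ a↪b = Data.Fin.Properties.injective⇒≤ (Embeds.index-injective a↪b)

mutual-embedding⇒≡ : ∀ {K} {a b : Fin K → ℕ} → Nonincreasing a → Nonincreasing b →
  Embeds a b → Embeds b a → ∀ i → a i ≡ b i
mutual-embedding⇒≡ a↓ b↓ a↪b b↪a i =
  ≤-antisym (reindex-≤ σ σ-inj b↓ a↓ a≡b∘σ i) (reindex-≤ τ τ-inj a↓ b↓ b≡a∘τ i)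
  where
  open Embeds a↪b renaming (index to σ; index-injective to σ-inj; reindexes to a≡b∘σ)
  open Embeds b↪a renaming (index to τ; index-injective to τ-inj; reindexes to b≡a∘τ)

otherIndex : ∀ {k} → 2 ≤ k → Fin k → Fin k
otherIndex (s≤s (s≤s _)) fz     = fs fz
otherIndex (s≤s (s≤s _)) (fs _) = fz

otherIndex≢ : ∀ {k} (2≤k : 2 ≤ k) i → otherIndex 2≤k i ≢ i
otherIndex≢ (s≤s (s≤s _)) fz     ()
otherIndex≢ (s≤s (s≤s _)) (fs _) ()

Exhausts : ∀ {K} → Fin K → Fin K → Set
Exhausts i j = ∀ l → l ≡ i ⊎ l ≡ j

Exhausts⇒≡ : ∀ {K} {i j j′ : Fin K} → Exhausts i j → j′ ≢ i → j′ ≡ j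
Exhausts⇒≡ {j′ = j′} i,j j′≢i = [ ⊥-elim ∘ j′≢i , id ]′ (i,j j′)

HasSquarePartner : ∀ {K} → (Fin K → ℕ) → Fin K → Set
HasSquarePartner a i = ∃[ j ] j ≢ i × Exhausts i j × 2 ≤ a j

hasSquarePartner? : ∀ {K} (a : Fin K → ℕ) i → Dec (HasSquarePartner a i)
hasSquarePartner? a i = any? λ j → ¬? (j ≟ᶠ i) ×-dec all? (λ l → (l ≟ᶠ i) ⊎-dec (l ≟ᶠ j)) ×-dec (2 ≤? a j)

-- The number of vertices of Υ_n private to pᵢ, for n = ∏ pⱼ^aⱼ: the aᵢ powers of pᵢ, plus n/pⱼ
-- when i, j are the only indices and pⱼ² ∣ n.
privateCount : ∀ {K} → (Fin K → ℕ) → Fin K → ℕ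
privateCount a i with hasSquarePartner? a i
... | yes _ = suc (a i)
... | no  _ = a i

module _ {K} (a : Fin K → ℕ) where

  privateCount-partner : ∀ {i} → HasSquarePartner a i → privateCount a i ≡ suc (a i)
  privateCount-partner {i} partner with hasSquarePartner? a i
  ... | yes _ = refl
  ... | no ¬partner = ⊥-elim (¬partner partner)

  privateCount-no-partner : ∀ {i} → ¬ HasSquarePartner a i → privateCount a i ≡ a i
  privateCount-no-partner {i} ¬partner with hasSquarePartner? a i
  ... | yes partner = ⊥-elim (¬partner partner)
  ... | no _ = refl

  ≤privateCount : ∀ i → a i ≤ privateCount a i
  ≤privateCount i with hasSquarePartner? a i
  ... | yes _ = n≤1+n (a i)
  ... | no  _ = ≤-refl

  privateCount≤ : ∀ i → privateCount a i ≤ suc (a i)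
  privateCount≤ i with hasSquarePartner? a i
  ... | yes _ = ≤-refl
  ... | no  _ = n≤1+n (a i)

  squarePartner : ∀ {i j} → j ≢ i → Exhausts i j → 2 ≤ a j → HasSquarePartner a i
  squarePartner j≢i i,j 2≤aj = _ , j≢i , i,j , 2≤aj

  privateCount-nonincreasing : Nonincreasing a → Nonincreasing (privateCount a)
  privateCount-nonincreasing a↓ i j i≤j = by-cases (hasSquarePartner? a j)
    where
    by-cases : Dec (HasSquarePartner a j) → privateCount a j ≤ privateCount a i
    by-cases (no ¬partner) = begin
      privateCount a j ≡⟨ privateCount-no-partner ¬partner ⟩
      a j              ≤⟨ a↓ i j i≤j ⟩
      a i              ≤⟨ ≤privateCount i ⟩
      privateCount a i ∎
      where open ≤-Reasoning
    by-cases (yes (i′ , i′≢j , j,i′ , 2≤ai′)) with j,i′ i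
    ... | inj₁ refl = ≤-refl
    ... | inj₂ refl with 2 ≤? a j
    ...   | yes 2≤aj = begin
      privateCount a j ≡⟨ privateCount-partner (squarePartner i′≢j j,i′ 2≤ai′) ⟩
      suc (a j)        ≤⟨ s≤s (a↓ i j i≤j) ⟩
      suc (a i)        ≡⟨ sym (privateCount-partner (squarePartner (≢-sym i′≢j) (swap ∘ j,i′) 2≤aj)) ⟩
      privateCount a i ∎
      where open ≤-Reasoning
    ...   | no 2≰aj = begin
      privateCount a j ≤⟨ privateCount≤ j ⟩
      suc (a j)        ≤⟨ ≰⇒> 2≰aj ⟩
      2                ≤⟨ 2≤ai′ ⟩
      a i              ≤⟨ ≤privateCount i ⟩
      privateCount a i ∎
      where open ≤-Reasoning

-- Without monotonicity this fails: privateCount takes the value (2 , 2) on both (2 , 1) and (1 , 2).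
squarePartner-transfer : ∀ {K} {a b : Fin K → ℕ} → Nonincreasing a → Nonincreasing b → (∀ i → 1 ≤ a i) →
  (∀ i → privateCount a i ≡ privateCount b i) → ∀ {i} → HasSquarePartner a i → HasSquarePartner b i
squarePartner-transfer {a = a} {b} a↓ b↓ a>0 ca≡cb {i} partner@(j , j≢i , i,j , 2≤aj)
  with hasSquarePartner? b i
... | yes partnerᵇ = partnerᵇ
... | no ¬partnerᵇ = ⊥-elim ([ <⇒≱ ai<aj ∘ a↓ i j , <⇒≱ bj<bi ∘ b↓ j i ]′ (≤-total (toℕ i) (toℕ j)))
  where
  open ≤-Reasoning
  bj<2 : b j < 2
  bj<2 = ≰⇒> (¬partnerᵇ ∘ squarePartner b j≢i i,j)
  bi≡1+ai : b i ≡ suc (a i)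
  bi≡1+ai = begin-equality
    b i              ≡⟨ privateCount-no-partner b ¬partnerᵇ ⟨
    privateCount b i ≡⟨ ca≡cb i ⟨
    privateCount a i ≡⟨ privateCount-partner a partner ⟩
    suc (a i)        ∎
  caj≤2 : privateCount a j ≤ 2
  caj≤2 = begin
    privateCount a j ≡⟨ ca≡cb j ⟩
    privateCount b j ≤⟨ privateCount≤ b j ⟩
    suc (b j)        ≤⟨ bj<2 ⟩
    2                ∎
  ai<2 : a i < 2
  ai<2 = ≰⇒> λ 2≤ai → <⇒≱ (begin-strict
    privateCount a j ≤⟨ caj≤2 ⟩
    2                <⟨ s≤s 2≤aj ⟩
    suc (a j)        ≡⟨ privateCount-partner a (squarePartner a (≢-sym j≢i) (swap ∘ i,j) 2≤ai) ⟨
    privateCount a j ∎) ≤-refl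
  ai<aj : a i < a j
  ai<aj = <-≤-trans ai<2 2≤aj
  bj<bi : b j < b i
  bj<bi = <-≤-trans bj<2 (subst (2 ≤_) (sym bi≡1+ai) (s≤s (a>0 i)))

privateCount-injective : ∀ {K} {a b : Fin K → ℕ} → Nonincreasing a → Nonincreasing b →
  (∀ i → 1 ≤ a i) → (∀ i → 1 ≤ b i) → (∀ i → privateCount a i ≡ privateCount b i) → ∀ i → a i ≡ b i
privateCount-injective {a = a} {b} a↓ b↓ a>0 b>0 ca≡cb i with hasSquarePartner? a i
... | yes partner = suc-injective (begin
  suc (a i)        ≡⟨ privateCount-partner a partner ⟨
  privateCount a i ≡⟨ ca≡cb i ⟩
  privateCount b i ≡⟨ privateCount-partner b (squarePartner-transfer a↓ b↓ a>0 ca≡cb partner) ⟩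
  suc (b i)        ∎)
  where open ≡-Reasoning
... | no ¬partner = begin
  a i              ≡⟨ privateCount-no-partner a ¬partner ⟨
  privateCount a i ≡⟨ ca≡cb i ⟩
  privateCount b i ≡⟨ privateCount-no-partner b (¬partner ∘ squarePartner-transfer b↓ a↓ b>0 (sym ∘ ca≡cb)) ⟩
  b i              ∎
  where open ≡-Reasoning

privateCounts-embed⇒similar : ∀ {k l} {α : Fin k → ℕ} {β : Fin l → ℕ} → Nonincreasing α → Nonincreasing β →
  (∀ i → 1 ≤ α i) → (∀ j → 1 ≤ β j) →
  Embeds (privateCount α) (privateCount β) → Embeds (privateCount β) (privateCount α) →
  (k ≡ l) × (∀ i j → toℕ i ≡ toℕ j → α i ≡ β j)
privateCounts-embed⇒similar {α = α} {β} α↓ β↓ α>0 β>0 cα↪cβ cβ↪cα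
  with ≤-antisym (Embeds⇒≤ cα↪cβ) (Embeds⇒≤ cβ↪cα)
... | refl = refl , λ i j i≡j → subst (λ j → α i ≡ β j) (toℕ-injective i≡j) (α≡β i)
  where
  α≡β : ∀ i → α i ≡ β i
  α≡β = privateCount-injective α↓ β↓ α>0 β>0
    (mutual-embedding⇒≡ (privateCount-nonincreasing α α↓) (privateCount-nonincreasing β β↓) cα↪cβ cβ↪cα)

ProperDivisor-ext : ∀ {n} {u v : ProperDivisor n} → val u ≡ val v → u ≡ v
ProperDivisor-ext {u = pd x 1<x x<n x∣n} {pd .x 1<x′ x<n′ x∣n′} refl
  rewrite <-irrelevant 1<x 1<x′ | <-irrelevant x<n x<n′ | ∣-irrelevant (<-trans z<s 1<x′) x∣n x∣n′ = refl

ΥIso⇒GraphIso : ∀ {n m} → ΥIso n m → GraphIso (Adj n) (Adj m)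
ΥIso⇒GraphIso iso = record { vertices = ⤖⇒↔ (ΥIso.bij iso) ; adjacent = ΥIso.adj-iff iso }

cofactor>1 : ∀ {n d} (a : ProperDivisor n) → n ≡ d * val a → 1 < d
cofactor>1 {n} a n≡d*a = ≢0∧≢1⇒2≤
  (λ { refl → <-irrefl (sym n≡d*a) (<-trans z<s (<-trans (1<val a) (val<n a))) })
  (λ { refl → <-irrefl (sym (trans n≡d*a (+-identityʳ (val a)))) (val<n a) })

pendant-multiple : ∀ {n a c d} → Pendant (Adj n) a c → n ≡ d * val a →
  ∀ e → e ∣ val a → 0 < e → e < val a → d * e ≡ val a ⊎ d * e ≡ val c
pendant-multiple {n} {a} {c} {d} (_ , unique) n≡d*x e e∣x 0<e e<x with d * e ≟ val a
... | yes de≡x = inj₁ de≡x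
... | no de≢x = inj₂ (cong val (unique de (≢-sym de≢x , n∣x*de)))
  where
  x = val a
  1<d = cofactor>1 a n≡d*x
  instance d≢0 = >-nonZero (<-trans z<s 1<d)
  de : ProperDivisor n
  de = pd (d * e) (<-≤-trans 1<d (m≤m*n d e {{>-nonZero 0<e}}))
    (subst (d * e <_) (sym n≡d*x) (*-monoʳ-< d e<x)) (subst (d * e ∣_) (sym n≡d*x) (*-monoʳ-∣ d e∣x))
  n∣x*de : n ∣ x * (d * e)
  n∣x*de = divides e (begin
    x * (d * e) ≡⟨ sym (*-assoc x d e) ⟩
    x * d * e   ≡⟨ cong (_* e) (trans (*-comm x d) (sym n≡d*x)) ⟩
    n * e       ≡⟨ *-comm n e ⟩
    e * n       ∎)
    where open ≡-Reasoning

-- For composite x = y r the multiples of n / x by e = 1, r, y give two distinct neighbours of x,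
-- unless y = r and n is r³ or r⁴.
module _ {n} (notPrimePower : ∀ {r} t → Prime r → n ≢ r ^ t) where

  pendant⇒prime : ∀ {a c} → Pendant (Adj n) a c → Prime (val a)
  pendant⇒prime {a} {c} pendant with prime-factor (val a) (1<val a)
  ... | r , y , pr , x≡y*r with y ≟ 1
  ...   | yes refl = subst Prime (sym (trans x≡y*r (+-identityʳ r))) pr
  ...   | no y≢1 = ⊥-elim (not-composite (val∣n a))
    where
    x = val a
    open ≡-Reasoning
    instance r≢0 = prime⇒nonZero pr
    2≤r = prime⇒2≤ pr
    2≤y : 2 ≤ y
    2≤y = ≢0∧≢1⇒2≤ (λ { refl → <-irrefl (sym x≡y*r) (<-trans z<s (1<val a)) }) y≢1
    instance y≢0 = >-nonZero (<-trans z<s 2≤y)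
    not-composite : x ∣ n → ⊥
    not-composite (divides d n≡d*x) = contradiction
      where
      instance d≢0 = >-nonZero (<-trans z<s (cofactor>1 a n≡d*x))
      multiple = pendant-multiple {n} {a} {c} {d} pendant n≡d*x
      x≡r*y : x ≡ r * y
      x≡r*y = trans x≡y*r (*-comm y r)
      d∈ = multiple 1 (1∣ x) z<s (1<val a)
      dr∈ = multiple r (divides y x≡y*r) (<-trans z<s 2≤r) (subst (r <_) (sym x≡r*y) (m<m*n r y 2≤y))
      dy∈ = multiple y (divides r x≡r*y) (<-trans z<s 2≤y) (subst (y <_) (sym x≡y*r) (m<m*n y r 2≤r))
      contradiction : ⊥
      contradiction with two-of-three-equal d∈ dr∈ dy∈
      ... | inj₁ d1≡dr = <-irrefl (*-cancelˡ-≡ 1 r d d1≡dr) 2≤r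
      ... | inj₂ (inj₁ d1≡dy) = y≢1 (sym (*-cancelˡ-≡ 1 y d d1≡dy))
      ... | inj₂ (inj₂ dr≡dy) with *-cancelˡ-≡ r y d dr≡dy
      ...   | refl with distinct⇒one≡first (λ d1≡dr → <-irrefl (*-cancelˡ-≡ 1 r d d1≡dr) 2≤r) d∈ dr∈
      ...     | inj₁ d1≡x = notPrimePower 4 pr (begin
                  n                 ≡⟨ n≡d*x ⟩
                  d * x             ≡⟨ cong (_* x) (trans (sym (*-identityʳ d)) d1≡x) ⟩
                  x * x             ≡⟨ cong (λ z → z * z) x≡y*r ⟩
                  (r * r) * (r * r) ≡⟨ [m*m]*[m*m]≡m^4 r ⟩
                  r ^ 4             ∎)
      ...     | inj₂ dr≡x = notPrimePower 3 pr (begin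
                  n           ≡⟨ n≡d*x ⟩
                  d * x       ≡⟨ cong (_* x) (*-cancelʳ-≡ d r r (trans dr≡x x≡y*r)) ⟩
                  r * x       ≡⟨ cong (r *_) x≡y*r ⟩
                  r * (r * r) ≡⟨ m*[m*m]≡m^3 r ⟩
                  r ^ 3       ∎)

module Structure {n k p α} (F : OrderedFactorization n k p α) (2≤k : 2 ≤ k) where
  open OrderedFactorization F renaming (prime to isPrime; distinct to p-injective; pos to α>0; eq to n≡Π)

  instance
    n≢0 : NonZero n
    n≢0 = subst NonZero (sym n≡Π) (primePowerProduct≢0 p α isPrime)
    p≢0 : ∀ {i} → NonZero (p i)
    p≢0 = prime⇒nonZero (isPrime _)

  p^α∣n : ∀ i → p i ^ α i ∣ n
  p^α∣n i = subst (_ ∣_) (sym n≡Π) (^∣primePowerProduct p α isPrime i)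

  p∣n : ∀ i → p i ∣ n
  p∣n i = ∣-trans (subst (_∣ p i ^ α i) (*-identityʳ (p i)) (^-monoʳ-∣ (p i) (α>0 i))) (p^α∣n i)

  prime∣n⇒≡p : ∀ {r} → Prime r → r ∣ n → ∃[ i ] r ≡ p i
  prime∣n⇒≡p pr r∣n = prime∣primePowerProduct p α isPrime pr (subst (_ ∣_) n≡Π r∣n)

  p^t∣n⇒t≤α : ∀ i t → p i ^ t ∣ n → t ≤ α i
  p^t∣n⇒t≤α i t = ^∣primePowerProduct⇒≤ p α isPrime p-injective i t ∘ subst (_ ∣_) n≡Π

  p∤p^ : ∀ {i j} t → i ≢ j → ¬ p i ∣ p j ^ t
  p∤p^ t i≢j = i≢j ∘ p-injective ∘ prime∣^⇒≡ t (isPrime _) (isPrime _)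

  p∤p : ∀ {i j} → i ≢ j → ¬ p i ∣ p j
  p∤p i≢j = i≢j ∘ p-injective ∘ prime∣prime⇒≡ (isPrime _) (isPrime _)

  other : Fin k → Fin k
  other = otherIndex 2≤k

  other≢ : ∀ i → other i ≢ i
  other≢ = otherIndex≢ 2≤k

  notPrimePower : ∀ {r} t → Prime r → n ≢ r ^ t
  notPrimePower t pr n≡r^t = other≢ i (p-injective (trans (p≡r (other i)) (sym (p≡r i))))
    where
    i = fromℕ< (<-trans z<s 2≤k)
    p≡r : ∀ j → p j ≡ _
    p≡r j = prime∣^⇒≡ t (isPrime j) pr (subst (p j ∣_) n≡r^t (p∣n j))

  ∣n∧p∤⇒<n : ∀ {x} j → x ∣ n → ¬ p j ∣ x → x < n
  ∣n∧p∤⇒<n j x∣n pj∤x = ≤∧≢⇒< (∣⇒≤ x∣n) λ { refl → pj∤x (p∣n j) }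

  n/p : Fin k → ℕ
  n/p i = quotient (p∣n i)

  instance
    n/p≢0 : ∀ {i} → NonZero (n/p i)
    n/p≢0 = quotient≢0 (p∣n _)

  n≡n/p*p : ∀ i → n ≡ n/p i * p i
  n≡n/p*p i = m∣n⇒n≡quotient*m (p∣n i)

  p<n : ∀ i → p i < n
  p<n i = ∣n∧p∤⇒<n (other i) (p∣n i) (p∤p (other≢ i))

  n/p-injective : Injective _≡_ _≡_ n/p
  n/p-injective {i} {j} n/pᵢ≡n/pⱼ = p-injective (*-cancelˡ-≡ (p i) (p j) (n/p i) (begin
    n/p i * p i ≡⟨ n≡n/p*p i ⟨
    n           ≡⟨ n≡n/p*p j ⟩
    n/p j * p j ≡⟨ cong (_* p j) n/pᵢ≡n/pⱼ ⟨
    n/p i * p j ∎))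
    where open ≡-Reasoning

  p∣n/p : ∀ {i j} → j ≢ i → p j ∣ n/p i
  p∣n/p {i} {j} j≢i with euclidsLemma (n/p i) (p i) (isPrime j) (subst (p j ∣_) (n≡n/p*p i) (p∣n j))
  ... | inj₁ pⱼ∣n/pᵢ = pⱼ∣n/pᵢ
  ... | inj₂ pⱼ∣pᵢ   = ⊥-elim (p∤p j≢i pⱼ∣pᵢ)

  n∣*n/p⇔p∣ : ∀ i x → n ∣ x * n/p i ⇔ p i ∣ x
  n∣*n/p⇔p∣ i x = mk⇔
    (λ n∣x*n/p → *-cancelˡ-∣ (n/p i)
       (subst₂ _∣_ (n≡n/p*p i) (*-comm x (n/p i)) n∣x*n/p))
    (λ pᵢ∣x → subst₂ _∣_ (sym (n≡n/p*p i)) (*-comm (n/p i) x) (*-monoʳ-∣ (n/p i) pᵢ∣x))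

  2≤α⇔p∣n/p : ∀ i → 2 ≤ α i ⇔ p i ∣ n/p i
  2≤α⇔p∣n/p i = mk⇔
    (λ 2≤α → *-cancelʳ-∣ (p i) (subst₂ _∣_ (cong (p i *_) (*-identityʳ (p i))) (n≡n/p*p i)
       (∣-trans (^-monoʳ-∣ (p i) 2≤α) (p^α∣n i))))
    (λ { (divides w n/p≡w*p) → p^t∣n⇒t≤α i 2 (divides w (begin
       n                   ≡⟨ n≡n/p*p i ⟩
       n/p i * p i         ≡⟨ cong (_* p i) n/p≡w*p ⟩
       w * p i * p i       ≡⟨ *-assoc w (p i) (p i) ⟩
       w * (p i * p i)     ≡⟨ cong (λ z → w * (p i * z)) (*-identityʳ (p i)) ⟨
       w * p i ^ 2         ∎)) })
    where open ≡-Reasoning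

  atom : Fin k → ProperDivisor n
  atom i = pd (p i) (prime⇒2≤ (isPrime i)) (p<n i) (p∣n i)

  coatom : Fin k → ProperDivisor n
  coatom i = pd (n/p i) (quotient>1 (p∣n i) (p<n i))
    (quotient-< (p∣n i) {{prime⇒nonTrivial (isPrime i)}}) (quotient-∣ (p∣n i))

  Adj-coatom⇔ : ∀ v i → Adj n v (coatom i) ⇔ (val v ≢ n/p i × p i ∣ val v)
  Adj-coatom⇔ v i = mk⇔ (Data.Product.map₂ (Equivalence.to (n∣*n/p⇔p∣ i (val v))))
                        (Data.Product.map₂ (Equivalence.from (n∣*n/p⇔p∣ i (val v))))

  atom-pendant : ∀ i → Pendant (Adj n) (atom i) (coatom i)
  atom-pendant i = (pᵢ≢n/pᵢ , subst (_∣ p i * n/p i) (sym n≡p*n/p) ∣-refl) , unique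
    where
    n≡p*n/p : n ≡ p i * n/p i
    n≡p*n/p = trans (n≡n/p*p i) (*-comm (n/p i) (p i))
    pᵢ≢n/pᵢ : p i ≢ n/p i
    pᵢ≢n/pᵢ p≡n/p = notPrimePower 2 (isPrime i)
      (trans n≡p*n/p (cong (p i *_) (trans (sym p≡n/p) (sym (*-identityʳ (p i))))))
    unique : ∀ w → Adj n (atom i) w → w ≡ coatom i
    unique w (_ , n∣p*w) with *-cancelˡ-∣ (p i) (subst (_∣ p i * val w) n≡p*n/p n∣p*w)
    ... | divides e w≡e*n/p
      with prime⇒irreducible (isPrime i) {e}
             (*-cancelʳ-∣ (n/p i) (subst₂ _∣_ w≡e*n/p n≡p*n/p (val∣n w)))
    ...   | inj₁ refl = ProperDivisor-ext (trans w≡e*n/p (*-identityˡ (n/p i)))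
    ...   | inj₂ refl = ⊥-elim (<-irrefl (trans w≡e*n/p (sym n≡p*n/p)) (val<n w))

  pendant⇒atom : ∀ {a c} → Pendant (Adj n) a c → ∃[ i ] a ≡ atom i × c ≡ coatom i
  pendant⇒atom {a} {c} pendant@(a~c , _)
    with prime∣n⇒≡p (pendant⇒prime {n} notPrimePower {a} {c} pendant) (val∣n a)
  ... | i , a≡pᵢ = i , a≡atom , proj₂ (atom-pendant i) c (subst (λ x → Adj n x c) a≡atom a~c)
    where
    a≡atom : a ≡ atom i
    a≡atom = ProperDivisor-ext a≡pᵢ

  AdjacentOnlyTo : Fin k → ProperDivisor n → Set
  AdjacentOnlyTo i v = Adj n v (coatom i) × (∀ j → j ≢ i → ¬ Adj n v (coatom j))

  Private-atom⇔AdjacentOnlyTo : ∀ i v → Private (Adj n) (atom i) v ⇔ AdjacentOnlyTo i v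
  Private-atom⇔AdjacentOnlyTo i v = mk⇔
    (λ (adjacentToAnchor , avoidsOthers) →
       adjacentToAnchor (coatom i) (atom-pendant i) ,
       λ j j≢i → avoidsOthers (atom j) (coatom j) (atom-pendant j) (j≢i ∘ p-injective ∘ cong val))
    (λ (v~cᵢ , v≁cⱼ) →
       (λ c (atom~c , _) → subst (Adj n v) (sym (proj₂ (atom-pendant i) c atom~c)) v~cᵢ) ,
       λ a′ c′ pendant a′≢aᵢ → case pendant⇒atom {a′} {c′} pendant of λ where
         (j , refl , refl) → v≁cⱼ j (λ { refl → a′≢aᵢ refl }))

  OnlyPrimeFactor : Fin k → ProperDivisor n → Set
  OnlyPrimeFactor i v = p i ∣ val v × (∀ j → j ≢ i → ¬ p j ∣ val v)

  PartnerCoatom : Fin k → ProperDivisor n → Set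
  PartnerCoatom i v = Σ (HasSquarePartner α i) λ partner → v ≡ coatom (proj₁ partner)

  adjacentOnlyTo⇒ : ∀ i v → AdjacentOnlyTo i v → OnlyPrimeFactor i v ⊎ PartnerCoatom i v
  adjacentOnlyTo⇒ i v (v~cᵢ , v≁cⱼ) with any? (λ j → ¬? (j ≟ᶠ i) ×-dec (p j ∣? val v))
  ... | no ¬∃pⱼ∣v = inj₁ (pᵢ∣v , λ j j≢i pⱼ∣v → ¬∃pⱼ∣v (j , j≢i , pⱼ∣v))
    where pᵢ∣v = proj₂ (Equivalence.to (Adj-coatom⇔ v i) v~cᵢ)
  ... | yes (j , j≢i , pⱼ∣v) = inj₂ ((j , j≢i , i,j , 2≤α) , ProperDivisor-ext v≡n/pⱼ)
    where
    v≡n/p : ∀ {l} → l ≢ i → p l ∣ val v → val v ≡ n/p l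
    v≡n/p {l} l≢i pₗ∣v with val v ≟ n/p l
    ... | yes v≡n/pₗ = v≡n/pₗ
    ... | no v≢n/pₗ = ⊥-elim (v≁cⱼ l l≢i (Equivalence.from (Adj-coatom⇔ v l) (v≢n/pₗ , pₗ∣v)))
    v≡n/pⱼ = v≡n/p j≢i pⱼ∣v
    i,j : Exhausts i j
    i,j l with l ≟ᶠ i | l ≟ᶠ j
    ... | yes l≡i | _       = inj₁ l≡i
    ... | no _    | yes l≡j = inj₂ l≡j
    ... | no l≢i  | no l≢j  = ⊥-elim (l≢j (n/p-injective (trans (sym (v≡n/p l≢i pₗ∣v)) v≡n/pⱼ)))
      where pₗ∣v = subst (p l ∣_) (sym v≡n/pⱼ) (p∣n/p l≢j)
    2≤α = Equivalence.from (2≤α⇔p∣n/p j) (subst (p j ∣_) v≡n/pⱼ pⱼ∣v)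

  adjacentOnlyTo⇐ : ∀ i v → OnlyPrimeFactor i v ⊎ PartnerCoatom i v → AdjacentOnlyTo i v
  adjacentOnlyTo⇐ i v (inj₁ (pᵢ∣v , pⱼ∤v)) =
    Equivalence.from (Adj-coatom⇔ v i) (v≢n/pᵢ , pᵢ∣v) ,
    λ j j≢i v~cⱼ → pⱼ∤v j j≢i (proj₂ (Equivalence.to (Adj-coatom⇔ v j) v~cⱼ))
    where
    v≢n/pᵢ : val v ≢ n/p i
    v≢n/pᵢ v≡n/pᵢ = pⱼ∤v (other i) (other≢ i) (subst (_ ∣_) (sym v≡n/pᵢ) (p∣n/p (other≢ i)))
  adjacentOnlyTo⇐ i _ (inj₂ ((j , j≢i , i,j , _) , refl)) =
    Equivalence.from (Adj-coatom⇔ (coatom j) i) (j≢i ∘ n/p-injective , p∣n/p (≢-sym j≢i)) ,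
    λ l l≢i cⱼ~cₗ → case i,j l of λ where
      (inj₁ l≡i) → l≢i l≡i
      (inj₂ refl) → proj₁ cⱼ~cₗ refl

  Private-atom⇔ : ∀ i v → Private (Adj n) (atom i) v ⇔ (OnlyPrimeFactor i v ⊎ PartnerCoatom i v)
  Private-atom⇔ i v = ⇔-trans (Private-atom⇔AdjacentOnlyTo i v) (mk⇔ (adjacentOnlyTo⇒ i v) (adjacentOnlyTo⇐ i v))

  power : ∀ i → Fin (α i) → ProperDivisor n
  power i t = pd (p i ^ suc (toℕ t)) 1<p^ (∣n∧p∤⇒<n (other i) p^∣n (p∤p^ (suc (toℕ t)) (other≢ i))) p^∣n
    where
    p^∣n : p i ^ suc (toℕ t) ∣ n
    p^∣n = ∣-trans (^-monoʳ-∣ (p i) (toℕ<n t)) (p^α∣n i)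
    1<p^ : 1 < p i ^ suc (toℕ t)
    1<p^ = *-mono-≤ (prime⇒2≤ (isPrime i)) (m^n>0 (p i) (toℕ t))

  powers : ∀ i → Enumeration (OnlyPrimeFactor i) (α i)
  powers i = record
    { elem            = power i
    ; elem∈           = λ t → m∣m*n _ , λ j j≢i → p∤p^ (suc (toℕ t)) j≢i
    ; elem-injective  = toℕ-injective ∘ suc-injective ∘ ^-injectiveʳ (isPrime i) ∘ cong val
    ; elem-surjective = surjective
    }
    where
    surjective : ∀ v → OnlyPrimeFactor i v → ∃[ t ] power i t ≡ v
    surjective v (_ , pⱼ∤v)
      with onlyPrimeFactor⇒power {p i} {val v} {{>-nonZero (<-trans z<s (1<val v))}} onlyPᵢ
      where
      onlyPᵢ : ∀ r → Prime r → r ∣ val v → r ≡ p i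
      onlyPᵢ r pr r∣v with prime∣n⇒≡p pr (∣-trans r∣v (val∣n v))
      ... | j , refl with j ≟ᶠ i
      ...   | yes refl = refl
      ...   | no j≢i = ⊥-elim (pⱼ∤v j j≢i r∣v)
    ... | zero  , v≡1     = ⊥-elim (<-irrefl (sym v≡1) (1<val v))
    ... | suc s , v≡p^s+1 = fromℕ< s<α , ProperDivisor-ext (begin
      p i ^ suc (toℕ (fromℕ< s<α)) ≡⟨ cong (λ z → p i ^ suc z) (toℕ-fromℕ< s<α) ⟩
      p i ^ suc s                  ≡⟨ v≡p^s+1 ⟨
      val v                        ∎)
      where
      open ≡-Reasoning
      s<α : s < α i
      s<α = p^t∣n⇒t≤α i (suc s) (subst (_∣ n) v≡p^s+1 (val∣n v))

  coatom∉powers : ∀ {i j} → j ≢ i → 2 ≤ α j → ¬ OnlyPrimeFactor i (coatom j)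
  coatom∉powers j≢i 2≤αⱼ (_ , pₗ∤cⱼ) = pₗ∤cⱼ _ j≢i (Equivalence.to (2≤α⇔p∣n/p _) 2≤αⱼ)

  Private-atom⇔-no-partner : ∀ {i} → ¬ HasSquarePartner α i → ∀ v → Private (Adj n) (atom i) v ⇔ OnlyPrimeFactor i v
  Private-atom⇔-no-partner ¬partner v = ⇔-trans (Private-atom⇔ _ v)
    (mk⇔ [ id , (λ (partner , _) → ⊥-elim (¬partner partner)) ]′ inj₁)

  Private-atom⇔-partner : ∀ {i j} → j ≢ i → Exhausts i j → 2 ≤ α j →
    ∀ v → Private (Adj n) (atom i) v ⇔ (OnlyPrimeFactor i v ⊎ v ≡ coatom j)
  Private-atom⇔-partner j≢i i,j 2≤αⱼ v = ⇔-trans (Private-atom⇔ _ v) (mk⇔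
    (Data.Sum.map₂ λ ((_ , j′≢i , _) , v≡cⱼ′) → trans v≡cⱼ′ (cong coatom (Exhausts⇒≡ i,j j′≢i)))
    (Data.Sum.map₂ ((_ , j≢i , i,j , 2≤αⱼ) ,_)))

  Private-atom-size : ∀ i → Enumeration (Private (Adj n) (atom i)) (privateCount α i)
  Private-atom-size i with hasSquarePartner? α i
  ... | no ¬partner =
    Enumeration-cong (λ v → ⇔-sym (Private-atom⇔-no-partner ¬partner v)) (powers i)
  ... | yes (j , j≢i , i,j , 2≤αⱼ) =
    Enumeration-suc (coatom j) (coatom∉powers j≢i 2≤αⱼ) (Private-atom⇔-partner j≢i i,j 2≤αⱼ) (powers i)

module Correspondence {n m k l p α q β} (F : OrderedFactorization n k p α) (G : OrderedFactorization m l q β)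
  (2≤k : 2 ≤ k) (2≤l : 2 ≤ l) (Υ≅ : GraphIso (Adj n) (Adj m)) where
  module N = Structure F 2≤k
  module M = Structure G 2≤l
  open GraphIso Υ≅
  open Inverse vertices

  -- Opaque: otherwise Agda unfolds the index through the prime factorisation and runs out of memory.
  opaque
    atom-image : ∀ i → ∃[ j ] to (N.atom i) ≡ M.atom j
    atom-image i = Data.Product.map₂ proj₁
      (M.pendant⇒atom {to (N.atom i)} {to (N.coatom i)} (Pendant-image Υ≅ (N.atom-pendant i)))

  index : Fin k → Fin l
  index = proj₁ ∘ atom-image

  index-injective : Injective _≡_ _≡_ index
  index-injective {i} {i′} j≡j′ = OrderedFactorization.distinct F (cong val (to-injective Υ≅ (begin
    to (N.atom i)      ≡⟨ proj₂ (atom-image i) ⟩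
    M.atom (index i)   ≡⟨ cong M.atom j≡j′ ⟩
    M.atom (index i′)  ≡⟨ proj₂ (atom-image i′) ⟨
    to (N.atom i′)     ∎)))
    where open ≡-Reasoning

  ≤privateCount-index : ∀ i → privateCount α i ≤ privateCount β (index i)
  ≤privateCount-index i = Private-size-≤ Υ≅ (N.Private-atom-size i)
    (subst (λ a → Enumeration (Private (Adj m) a) (privateCount β (index i)))
           (sym (proj₂ (atom-image i))) (M.Private-atom-size (index i)))

  privateCount-index≤ : ∀ i → privateCount β (index i) ≤ privateCount α i
  privateCount-index≤ i = Private-size-≤ (GraphIso-sym Υ≅) (M.Private-atom-size (index i))
    (subst (λ a → Enumeration (Private (Adj n) a) (privateCount α i))
           (trans (sym (strictlyInverseʳ (N.atom i))) (cong from (proj₂ (atom-image i))))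
           (N.Private-atom-size i))

  privateCounts-embed : Embeds (privateCount α) (privateCount β)
  privateCounts-embed = record
    { index           = index
    ; index-injective = index-injective
    ; reindexes       = λ i → ≤-antisym (≤privateCount-index i) (privateCount-index≤ i)
    }

proposition3p3 : (n m k l : ℕ) (p α : Fin k → ℕ) (q β : Fin l → ℕ) →
    2 ≤ k → 2 ≤ l →
    OrderedFactorization n k p α → OrderedFactorization m l q β →
    ΥIso n m →
    (k ≡ l) × (∀ (i : Fin k) (j : Fin l) → toℕ i ≡ toℕ j → α i ≡ β j)
proposition3p3 n m k l p α q β 2≤k 2≤l F G iso =
  privateCounts-embed⇒similar (nonincr F) (nonincr G) (pos F) (pos G)
    (Correspondence.privateCounts-embed F G 2≤k 2≤l Υ≅)
    (Correspondence.privateCounts-embed G F 2≤l 2≤k (GraphIso-sym Υ≅))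
  where
  open OrderedFactorization
  Υ≅ = ΥIso⇒GraphIso iso
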